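{- Suppose that $\varphi\leftrightarrow\varphi'$, $\theta\leftrightarrow\theta'$, $x=x'$, $y=y'$ and $x_i=x'_i$ (for all $i=1,\dots,n$) are provable in $\mathbf{DLKV}$. Then the following are also provable in $\mathbf{DLKV}$ (for every group $A$, supergroup $\mathfrak A$, event $e$, $n$-ary function symbol $F$ and $n$-ary predicate symbol $P$): (1) $x|_\varphi y=x'|_{\varphi'}y'$; (2) $F(x_1,\dots,x_n)=F(x'_1,\dots,x'_n)$; (3) $x_A^\varphi=(x')_A^{\varphi'}$; (4) $e(x)=e(x')$; (5) $Px_1\dots x_n\leftrightarrow Px'_1\dots x'_n$; (6) $\neg\varphi\leftrightarrow\neg\varphi'$; (7) $(\varphi\wedge\theta)\leftrightarrow(\varphi'\wedge\theta')$; (8) $K_A\varphi\leftrightarrow K_A\varphi'$; (9) $[e]\varphi\leftrightarrow[e]\varphi'$; (10) $C_{\mathfrak A}^\theta\varphi\leftrightarrow C_{\mathfrak A}^{\theta'}\varphi'$.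
   Context: Vocabulary: agents $\mathcal A$; constants $C$ containing $0,1$ and an "undefined" constant $\uparrow$; basic local variables $V$, each owned by an agent ($v_a$ owned by $a$); predicate symbols (including binary $=$) and function symbols with arities. Groups: finite non-empty $A\subseteq\mathcal A$; supergroups: finite non-empty sets $\mathfrak A$ of groups. Syntax of $DLKV$: terms $x::= c\mid v\mid x|_\varphi y\mid F(x_1,\dots,x_n)\mid x_A^\varphi\mid e(x)$; formulas $\varphi::=Px_1\dots x_n\mid\neg\varphi\mid\varphi\wedge\varphi\mid K_A\varphi\mid C_{\mathfrak A}^\theta\varphi\mid[e]\varphi$; events $e::=!\Phi/\sigma$, $\Phi$ a finite set of formulas, $\sigma$ assigning to each $v\in V$ a term $\sigma(v)$ and to each agent $a$ a set of agents $\sigma(a)$ with $a\in\sigma(a)$ and $K_a\sigma(v_a)\in\Phi$. $pre_e:=\bigwedge\Phi$, $e(a):=\sigma(a)$, $post_e(v):=\sigma(v)$, $e(A):=\bigcup_{a\in A}e(a)$, $e[\mathfrak A]:=\{e(A):A\in\mathfrak A\}$. Abbreviations: $\top:=(\uparrow=\uparrow)$, $x\!\uparrow:=(x=\uparrow)$, $x\!\downarrow:=\neg x\!\uparrow$; $\overline x=\overline y$ is $\bigwedge_ix_i=y_i$; $K_a:=K_{\{a\}}$; $K_A^\theta\varphi:=K_A(\theta\to\varphi)$; $K_A^\theta x:=K_A^\theta(x=x_A^\theta)$; $K_A^\theta\overline x:=\bigwedge_iK_A^\theta x_i$; $K_Ax:=K_A^\top x$; $\langle K_A\rangle\varphi:=\neg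 K_A\neg\varphi$; $\langle e\rangle\varphi:=\neg[e]\neg\varphi$. Proof system $\mathbf{DLKV}$: (I) classical propositional tautologies and modus ponens. (II) $x=x$; $\overline x=\overline y\to(P\overline x\,\overline z\leftrightarrow P\overline y\,\overline z)$; $\overline x=\overline y\to F(\overline x)=F(\overline y)$; $(\varphi\to x|_\varphi y=x)\wedge(\neg\varphi\to x|_\varphi y=y)$. (III) from $\varphi$ infer $K_A\varphi$; $K_A(\varphi\to\psi)\to(K_A\varphi\to K_A\psi)$; $K_A\varphi\to\varphi$; $K_A\varphi\to K_AK_A\varphi$; $\neg K_A\varphi\to K_A\neg K_A\varphi$; $K_A\varphi\to K_B\varphi$ if $A\subseteq B$. (IV) from $\varphi$ infer $C_{\mathfrak A}^\theta\varphi$; $C_{\mathfrak A}^\theta(\varphi\to\psi)\to(C_{\mathfrak A}^\theta\varphi\to C_{\mathfrak A}^\theta\psi)$; $C_{\mathfrak A}^\theta\varphi\to(\varphi\wedge\bigwedge_{A\in\mathfrak A}K_A^\theta C_{\mathfrak A}^\theta\varphi)$; $C_{\mathfrak A}^\theta(\varphi\to\bigwedge_{A\in\mathfrak A}K_A^\theta\varphi)\to(\varphi\to C_{\mathfrak A}^\theta\varphi)$. (V) $x_A^\varphi\!\downarrow\to(K_A^\varphi x\wedge\langle K_A\rangle\varphi)$; $K_ac\wedge K_av_a$; $K_Ax_A^\varphi$; $K_A\overline x\to(P\overline x\to K_AP\overline x)$; $K_A^\varphi\overline x\to K_A^\varphi F(\overline x)$; $K_A^\theta(x=y)\to(K_A^\theta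 x\to K_A^\theta y)$; $K_A(\varphi\to\theta)\to(K_A^\theta x\to K_A^\varphi x)$. (VI) from $\varphi$ infer $[e]\varphi$; $[e](\varphi\to\psi)\to([e]\varphi\to[e]\psi)$; $[e]Px_1\dots x_n\leftrightarrow(pre_e\to Pe(x_1)\dots e(x_n))$; $[e]\neg\varphi\leftrightarrow(pre_e\to\neg[e]\varphi)$; $[e]K_A\varphi\leftrightarrow(pre_e\to K_{e(A)}[e]\varphi)$; $[e]C_{\mathfrak A}^\theta\varphi\leftrightarrow(pre_e\to C_{e[\mathfrak A]}^{\langle e\rangle\theta}[e]\varphi)$. (VII) $e(x)\!\downarrow\to pre_e$; $pre_e\to e(c)=c$; $pre_e\to e(v)=post_e(v)$; $pre_e\to e(x|_\varphi y)=e(x)|_{\langle e\rangle\varphi}e(y)$; $pre_e\to e(F(x_1,\dots,x_n))=F(e(x_1),\dots,e(x_n))$; $pre_e\to e(x_A^\varphi)=e(x)_{e(A)}^{\langle e\rangle\varphi}$. -}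

module Defs where

open import Data.Nat using (ℕ; zero; suc; _+_)
open import Data.Bool using (Bool; true; false; not; _∧_)
open import Data.Vec using (Vec; []; _∷_; _++_)
import Data.Vec as Vec
open import Data.List using (List; []; _∷_)
import Data.List as List
open import Data.List.NonEmpty using (List⁺; _∷_; toList)
import Data.List.NonEmpty as List⁺
open import Data.List.Membership.Propositional using (_∈_)
open import Data.List.Relation.Binary.Subset.Propositional using (_⊆_)
open import Relation.Binary.PropositionalEquality using (_≡_)

record Sig : Set₁ where
  field
    Agent  : Set
    Const  : Set
    c0 c1  : Const
    cundef : Const
    Var    : Set
    owner  : Var → Agent
    Fun    : ℕ → Set
    Pred   : ℕ → Set
    eqP    : Pred 2

data PF : Set where
  atom : ℕ → PF
  pneg : PF → PF
  pand : PF → PF → PF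

evalPF : (ℕ → Bool) → PF → Bool
evalPF v (atom i)   = v i
evalPF v (pneg p)   = not (evalPF v p)
evalPF v (pand p q) = evalPF v p ∧ evalPF v q

Tautology : PF → Set
Tautology p = (v : ℕ → Bool) → evalPF v p ≡ true

module Syntax (S : Sig) where
  open Sig S public

  -- groups: finite non-empty sets of agents (as non-empty lists)
  Group : Set
  Group = List⁺ Agent

  -- supergroups: finite non-empty sets of groups
  SuperGroup : Set
  SuperGroup = List⁺ Group

  data Term  : Set
  data Form  : Set
  data Event : Set

  data Term where
    con  : Const → Term
    var  : Var → Term
    cond : Term → Form → Term → Term
    fun  : ∀ {n} → Fun n → Vec Term n → Term
    kn   : Term → Group → Form → Term
    app  : Event → Term → Term

  data Form where
    pred : ∀ {n} → Pred n → Vec Term n → Form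
    neg  : Form → Form
    and  : Form → Form → Form
    K    : Group → Form → Form
    C    : SuperGroup → Form → Form → Form     -- C_𝔄^θ φ  (C 𝔄 θ φ)
    box  : Event → Form → Form

  -- events !Φ/σ ; the last field says K_a σ(v_a) ∈ Φ, where
  -- K_a x = K_{a}(⊤ → x = x_{a}^⊤), ⊤ = (↑ = ↑), φ → ψ = ¬(φ ∧ ¬ψ)
  data Event where
    mkEvent : (Φ : List Form) (σv : Var → Term) (σa : Agent → List⁺ Agent)
            → (∀ a → a ∈ toList (σa a))
            → (∀ v → K (owner v ∷ [])
                        (neg (and (pred eqP (con cundef ∷ con cundef ∷ []))
                                  (neg (pred eqP (σv v ∷ kn (σv v) (owner v ∷ [])
                                         (pred eqP (con cundef ∷ con cundef ∷ [])) ∷ [])))))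
                     ∈ Φ)
            → Event

  infix  6 _≐_
  infixr 4 _⇒_
  infix  3 _⇔_

  _≐_ : Term → Term → Form
  x ≐ y = pred eqP (x ∷ y ∷ [])

  _⇒_ : Form → Form → Form
  φ ⇒ ψ = neg (and φ (neg ψ))

  _⇔_ : Form → Form → Form
  φ ⇔ ψ = and (φ ⇒ ψ) (ψ ⇒ φ)

  ↑ : Term
  ↑ = con cundef

  ⊤f : Form
  ⊤f = ↑ ≐ ↑

  undef : Term → Form
  undef x = x ≐ ↑

  defd : Term → Form
  defd x = neg (undef x)

  ⋀ : List Form → Form
  ⋀ []           = ⊤f
  ⋀ (φ ∷ [])     = φ
  ⋀ (φ ∷ ψ ∷ φs) = and φ (⋀ (ψ ∷ φs))

  eqs : ∀ {n} → Vec Term n → Vec Term n → Form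
  eqs xs ys = ⋀ (Vec.toList (Vec.zipWith _≐_ xs ys))

  single : Agent → Group
  single a = a ∷ []

  Kθ : Group → Form → Form → Form
  Kθ A θ φ = K A (θ ⇒ φ)

  KθT : Group → Form → Term → Form
  KθT A θ x = Kθ A θ (x ≐ kn x A θ)

  KθV : ∀ {n} → Group → Form → Vec Term n → Form
  KθV A θ xs = ⋀ (Vec.toList (Vec.map (KθT A θ) xs))

  KT : Group → Term → Form
  KT A x = KθT A ⊤f x

  KV : ∀ {n} → Group → Vec Term n → Form
  KV A xs = KθV A ⊤f xs

  dK : Group → Form → Form
  dK A φ = neg (K A (neg φ))

  dia : Event → Form → Form
  dia e φ = neg (box e (neg φ))

  pre : Event → Form
  pre (mkEvent Φ _ _ _ _) = ⋀ Φ

  post : Event → Var → Term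
  post (mkEvent _ σv _ _ _) = σv

  evA : Event → Agent → List⁺ Agent
  evA (mkEvent _ _ σa _ _) = σa

  evG : Event → Group → Group
  evG e A = List⁺.concatMap (evA e) A

  evSG : Event → SuperGroup → SuperGroup
  evSG e 𝔄 = List⁺.map (evG e) 𝔄

  inst : (ℕ → Form) → PF → Form
  inst s (atom i)   = s i
  inst s (pneg p)   = neg (inst s p)
  inst s (pand p q) = and (inst s p) (inst s q)

  infix 2 ⊢_
  data ⊢_ : Form → Set where
    taut : (p : PF) → Tautology p → (s : ℕ → Form) → ⊢ inst s p
    mp   : ∀ {φ ψ} → ⊢ φ → ⊢ φ ⇒ ψ → ⊢ ψ
    eq-refl  : (x : Term) → ⊢ x ≐ x
    eq-pred  : ∀ {m k} (P : Pred (m + k)) (xs ys : Vec Term m) (zs : Vec Term k)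
             → ⊢ eqs xs ys ⇒ (pred P (xs ++ zs) ⇔ pred P (ys ++ zs))
    eq-fun   : ∀ {n} (F : Fun n) (xs ys : Vec Term n)
             → ⊢ eqs xs ys ⇒ fun F xs ≐ fun F ys
    cond-ax  : (φ : Form) (x y : Term)
             → ⊢ and (φ ⇒ cond x φ y ≐ x) (neg φ ⇒ cond x φ y ≐ y)
    K-nec    : ∀ {φ} (A : Group) → ⊢ φ → ⊢ K A φ
    K-dist   : (A : Group) (φ ψ : Form) → ⊢ K A (φ ⇒ ψ) ⇒ (K A φ ⇒ K A ψ)
    K-T      : (A : Group) (φ : Form) → ⊢ K A φ ⇒ φ
    K-4      : (A : Group) (φ : Form) → ⊢ K A φ ⇒ K A (K A φ)
    K-5      : (A : Group) (φ : Form) → ⊢ neg (K A φ) ⇒ K A (neg (K A φ))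
    K-mono   : (A B : Group) → toList A ⊆ toList B → (φ : Form) → ⊢ K A φ ⇒ K B φ
    C-nec    : ∀ {φ} (𝔄 : SuperGroup) (θ : Form) → ⊢ φ → ⊢ C 𝔄 θ φ
    C-dist   : (𝔄 : SuperGroup) (θ φ ψ : Form)
             → ⊢ C 𝔄 θ (φ ⇒ ψ) ⇒ (C 𝔄 θ φ ⇒ C 𝔄 θ ψ)
    C-mix    : (𝔄 : SuperGroup) (θ φ : Form)
             → ⊢ C 𝔄 θ φ ⇒ and φ (⋀ (List.map (λ A → Kθ A θ (C 𝔄 θ φ)) (toList 𝔄)))
    C-ind    : (𝔄 : SuperGroup) (θ φ : Form)
             → ⊢ C 𝔄 θ (φ ⇒ ⋀ (List.map (λ A → Kθ A θ φ) (toList 𝔄))) ⇒ (φ ⇒ C 𝔄 θ φ)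
    kn-def   : (x : Term) (A : Group) (φ : Form)
             → ⊢ defd (kn x A φ) ⇒ and (KθT A φ x) (dK A φ)
    K-cv     : (c : Const) (v : Var)
             → ⊢ and (KT (single (owner v)) (con c)) (KT (single (owner v)) (var v))
    K-kn     : (x : Term) (A : Group) (φ : Form) → ⊢ KT A (kn x A φ)
    K-pred   : ∀ {n} (A : Group) (P : Pred n) (xs : Vec Term n)
             → ⊢ KV A xs ⇒ (pred P xs ⇒ K A (pred P xs))
    K-fun    : ∀ {n} (A : Group) (φ : Form) (F : Fun n) (xs : Vec Term n)
             → ⊢ KθV A φ xs ⇒ KθT A φ (fun F xs)
    K-eq     : (A : Group) (θ : Form) (x y : Term)
             → ⊢ Kθ A θ (x ≐ y) ⇒ (KθT A θ x ⇒ KθT A θ y)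
    K-weak   : (A : Group) (φ θ : Form) (x : Term)
             → ⊢ K A (φ ⇒ θ) ⇒ (KθT A θ x ⇒ KθT A φ x)
    box-nec  : ∀ {φ} (e : Event) → ⊢ φ → ⊢ box e φ
    box-dist : (e : Event) (φ ψ : Form) → ⊢ box e (φ ⇒ ψ) ⇒ (box e φ ⇒ box e ψ)
    box-pred : ∀ {n} (e : Event) (P : Pred n) (xs : Vec Term n)
             → ⊢ box e (pred P xs) ⇔ (pre e ⇒ pred P (Vec.map (app e) xs))
    box-neg  : (e : Event) (φ : Form) → ⊢ box e (neg φ) ⇔ (pre e ⇒ neg (box e φ))
    box-K    : (e : Event) (A : Group) (φ : Form)
             → ⊢ box e (K A φ) ⇔ (pre e ⇒ K (evG e A) (box e φ))
    box-C    : (e : Event) (𝔄 : SuperGroup) (θ φ : Form)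
             → ⊢ box e (C 𝔄 θ φ) ⇔ (pre e ⇒ C (evSG e 𝔄) (dia e θ) (box e φ))
    app-def  : (e : Event) (x : Term) → ⊢ defd (app e x) ⇒ pre e
    app-con  : (e : Event) (c : Const) → ⊢ pre e ⇒ app e (con c) ≐ con c
    app-var  : (e : Event) (v : Var) → ⊢ pre e ⇒ app e (var v) ≐ post e v
    app-cond : (e : Event) (x : Term) (φ : Form) (y : Term)
             → ⊢ pre e ⇒ app e (cond x φ y) ≐ cond (app e x) (dia e φ) (app e y)
    app-fun  : ∀ {n} (e : Event) (F : Fun n) (xs : Vec Term n)
             → ⊢ pre e ⇒ app e (fun F xs) ≐ fun F (Vec.map (app e) xs)
    app-kn   : (e : Event) (x : Term) (A : Group) (φ : Form)
             → ⊢ pre e ⇒ app e (kn x A φ) ≐ kn (app e x) (evG e A) (dia e φ)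

{-# OPTIONS --safe #-}
-- Most clauses follow from the equality axioms (II), necessitation and
-- distribution for K_A, [e] and C_𝔄^θ, the induction axiom for C_𝔄^θ (which makes
-- it antitone in θ), and propositional tautologies, checked here by truth tables.
-- The clauses that need an idea are x_A^φ and e(x); for both it suffices to prove
-- the equation when one side is defined, since two undefined terms both equal ↑.
-- If x_A^φ is defined then K_A^φ x and ⟨K_A⟩φ, so A knows that φ implies
-- x_A^φ = (x')_A^{φ'}. That equation between A-known values is A-known when
-- true, and by axiom 5 a possibly true A-known formula is true.
-- If e(x) is defined then pre_e holds, and then e(x) = e(x') is the reduction
-- of [e](x = x'), which holds by necessitation.
module Submission where

open import Defs
open import Data.Vec using (Vec; lookup)
open import Data.Fin using (Fin)
open import Data.Fin using (zero; suc)
open import Data.Product using (_×_)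
open import Data.Product using (_,_)
open import Data.Bool using (Bool; true; false; T; not; _∧_)
open import Data.Bool.Properties using (T-≡; T-∧)
open import Data.Nat using (ℕ; zero; suc; _<_; _≤_; _⊔_; s≤s)
open import Data.Nat.Properties using (≤-refl; m⊔n≤o⇒m≤o; m⊔n≤o⇒n≤o; +-identityʳ)
open import Data.List using (List; []; _∷_; map)
open import Data.List.NonEmpty using (toList)
open import Data.List.Relation.Unary.All using (All; []; _∷_)
open import Data.Vec using ([]; _∷_; _++_)
import Data.Vec as Vec
open import Data.Vec.Properties using (subst-is-cast; ++-identityʳ-eqFree)
open import Function using (_∘_; Equivalence)
open import Relation.Binary.PropositionalEquality using (_≡_; refl; sym; trans; cong; cong₂; subst)

open Equivalence using (to)

extend : List Bool → ℕ → Bool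
extend []       _       = false
extend (b ∷ _)  zero    = b
extend (_ ∷ bs) (suc i) = extend bs i

prefix : ℕ → (ℕ → Bool) → List Bool
prefix zero    v = []
prefix (suc k) v = v 0 ∷ prefix k (v ∘ suc)

extend-prefix : ∀ {i k} (v : ℕ → Bool) → i < k → extend (prefix k v) i ≡ v i
extend-prefix {zero}  {suc k} v _         = refl
extend-prefix {suc i} {suc k} v (s≤s i<k) = extend-prefix (v ∘ suc) i<k

width : PF → ℕ
width (atom i)   = suc i
width (pneg p)   = width p
width (pand p q) = width p ⊔ width q

evalPF-prefix : ∀ {k} (v : ℕ → Bool) (p : PF) → width p ≤ k
              → evalPF (extend (prefix k v)) p ≡ evalPF v p
evalPF-prefix v (atom i)   i<k = extend-prefix v i<k
evalPF-prefix v (pneg p)   w≤k = cong not (evalPF-prefix v p w≤k)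
evalPF-prefix v (pand p q) w≤k =
  cong₂ _∧_ (evalPF-prefix v p (m⊔n≤o⇒m≤o (width p) (width q) w≤k))
            (evalPF-prefix v q (m⊔n≤o⇒n≤o (width p) (width q) w≤k))

every : ℕ → (List Bool → Bool) → Bool
every zero    f = f []
every (suc k) f = every k (f ∘ (true ∷_)) ∧ every k (f ∘ (false ∷_))

every-sound : ∀ k f → T (every k f) → ∀ v → T (f (prefix k v))
every-sound zero    f h v = h
every-sound (suc k) f h v = by-head (v 0) (to T-∧ h)
  where
  by-head : ∀ b → T (every k (f ∘ (true ∷_))) × T (every k (f ∘ (false ∷_)))
          → T (f (b ∷ prefix k (v ∘ suc)))
  by-head true  (ht , _) = every-sound k _ ht (v ∘ suc)
  by-head false (_ , hf) = every-sound k _ hf (v ∘ suc)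

isTautology : PF → Bool
isTautology p = every (width p) (λ bs → evalPF (extend bs) p)

isTautology-sound : (p : PF) → T (isTautology p) → Tautology p
isTautology-sound p h v =
  trans (sym (evalPF-prefix v p ≤-refl))
        (to T-≡ (every-sound (width p) (λ bs → evalPF (extend bs) p) h v))

infixr 4 _⟶_
infix  3 _⟷_

_⟶_ : PF → PF → PF
p ⟶ q = pneg (pand p (pneg q))

_⟷_ : PF → PF → PF
p ⟷ q = pand (p ⟶ q) (q ⟶ p)

p₀ p₁ p₂ p₃ p₄ p₅ p₆ : PF
p₀ = atom 0
p₁ = atom 1
p₂ = atom 2
p₃ = atom 3
p₄ = atom 4
p₅ = atom 5
p₆ = atom 6

module Derivations (S : Sig) where
  open Syntax S

  assign : List Form → ℕ → Form
  assign []       _       = ⊤f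
  assign (φ ∷ _)  zero    = φ
  assign (_ ∷ φs) (suc i) = assign φs i

  tautology : (p : PF) {_ : T (isTautology p)} (φs : List Form) → ⊢ inst (assign φs) p
  tautology p {h} φs = taut p (isTautology-sound p h) (assign φs)

  infixr 4 _⇛_

  _⇛_ : List Form → Form → Form
  []       ⇛ ψ = ψ
  (φ ∷ φs) ⇛ ψ = φ ⇒ (φs ⇛ ψ)

  mp* : ∀ {φs ψ} → All ⊢_ φs → ⊢ φs ⇛ ψ → ⊢ ψ
  mp* []       h' = h'
  mp* (h ∷ hs) h' = mp* hs (mp h h')

  ∧-intro : ∀ {φ ψ} → ⊢ φ → ⊢ ψ → ⊢ and φ ψ
  ∧-intro {φ} {ψ} h h' = mp* (h ∷ h' ∷ []) (tautology (p₀ ⟶ p₁ ⟶ pand p₀ p₁) (φ ∷ ψ ∷ []))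

  ∧-proj₁⇒ : ∀ φ ψ → ⊢ and φ ψ ⇒ φ
  ∧-proj₁⇒ φ ψ = tautology (pand p₀ p₁ ⟶ p₀) (φ ∷ ψ ∷ [])

  ∧-proj₂⇒ : ∀ φ ψ → ⊢ and φ ψ ⇒ ψ
  ∧-proj₂⇒ φ ψ = tautology (pand p₀ p₁ ⟶ p₁) (φ ∷ ψ ∷ [])

  ⇒-trans : ∀ {φ ψ χ} → ⊢ φ ⇒ ψ → ⊢ ψ ⇒ χ → ⊢ φ ⇒ χ
  ⇒-trans {φ} {ψ} {χ} h h' =
    mp* (h ∷ h' ∷ []) (tautology ((p₀ ⟶ p₁) ⟶ (p₁ ⟶ p₂) ⟶ p₀ ⟶ p₂) (φ ∷ ψ ∷ χ ∷ []))

  ⇔-to : ∀ {φ ψ} → ⊢ φ ⇔ ψ → ⊢ φ ⇒ ψ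
  ⇔-to h = mp h (∧-proj₁⇒ _ _)

  ⇔-from : ∀ {φ ψ} → ⊢ φ ⇔ ψ → ⊢ ψ ⇒ φ
  ⇔-from h = mp h (∧-proj₂⇒ _ _)

  ⇔-sym : ∀ {φ ψ} → ⊢ φ ⇔ ψ → ⊢ ψ ⇔ φ
  ⇔-sym h = ∧-intro (⇔-from h) (⇔-to h)

  ⇔-lift : {F : Form → Form} → (∀ {φ ψ} → ⊢ φ ⇒ ψ → ⊢ F φ ⇒ F ψ)
         → ∀ {φ φ'} → ⊢ φ ⇔ φ' → ⊢ F φ ⇔ F φ'
  ⇔-lift F-map h = ∧-intro (F-map (⇔-to h)) (F-map (⇔-from h))

  neg-cong : ∀ {φ φ'} → ⊢ φ ⇔ φ' → ⊢ neg φ ⇔ neg φ'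
  neg-cong {φ} {φ'} h = mp h (tautology ((p₀ ⟷ p₁) ⟶ (pneg p₀ ⟷ pneg p₁)) (φ ∷ φ' ∷ []))

  and-cong : ∀ {φ φ' ψ ψ'} → ⊢ φ ⇔ φ' → ⊢ ψ ⇔ ψ' → ⊢ and φ ψ ⇔ and φ' ψ'
  and-cong {φ} {φ'} {ψ} {ψ'} h h' =
    mp* (h ∷ h' ∷ [])
        (tautology ((p₀ ⟷ p₁) ⟶ (p₂ ⟷ p₃) ⟶ (pand p₀ p₂ ⟷ pand p₁ p₃)) (φ ∷ φ' ∷ ψ ∷ ψ' ∷ []))

  ⋀-cons : ∀ {φ} φs → ⊢ φ → ⊢ ⋀ φs → ⊢ ⋀ (φ ∷ φs)
  ⋀-cons []      h _  = h
  ⋀-cons (_ ∷ _) h h' = ∧-intro h h'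

  ⋀-map-mono : ∀ {I : Set} {f g : I → Form} (is : List I) → (∀ i → ⊢ f i ⇒ g i)
             → ⊢ ⋀ (map f is) ⇒ ⋀ (map g is)
  ⋀-map-mono []           h = tautology (p₀ ⟶ p₀) (⊤f ∷ [])
  ⋀-map-mono (i ∷ [])     h = h i
  ⋀-map-mono {f = f} {g} (i ∷ j ∷ is) h =
    mp* (h i ∷ ⋀-map-mono (j ∷ is) h ∷ [])
        (tautology ((p₀ ⟶ p₁) ⟶ (p₂ ⟶ p₃) ⟶ pand p₀ p₂ ⟶ pand p₁ p₃)
                   (f i ∷ g i ∷ ⋀ (map f (j ∷ is)) ∷ ⋀ (map g (j ∷ is)) ∷ []))

  ≐-sym⇒ : ∀ x y → ⊢ x ≐ y ⇒ y ≐ x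
  ≐-sym⇒ x y =
    mp* (eq-pred eqP (x ∷ []) (y ∷ []) (x ∷ []) ∷ eq-refl x ∷ [])
        (tautology ((p₀ ⟶ (p₁ ⟷ p₂)) ⟶ p₁ ⟶ p₀ ⟶ p₂) (x ≐ y ∷ x ≐ x ∷ y ≐ x ∷ []))

  ≐-sym : ∀ {x y} → ⊢ x ≐ y → ⊢ y ≐ x
  ≐-sym h = mp h (≐-sym⇒ _ _)

  ≐-trans⇒ : ∀ x y z → ⊢ x ≐ y ⇒ y ≐ z ⇒ x ≐ z
  ≐-trans⇒ x y z =
    mp* (≐-sym⇒ x y ∷ eq-pred eqP (y ∷ []) (x ∷ []) (z ∷ []) ∷ [])
        (tautology ((p₀ ⟶ p₁) ⟶ (p₁ ⟶ (p₂ ⟷ p₃)) ⟶ p₀ ⟶ p₂ ⟶ p₃)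
                   (x ≐ y ∷ y ≐ x ∷ y ≐ z ∷ x ≐ z ∷ []))

  ≐-through : ∀ {u u'} c c' → ⊢ u ≐ u' → ⊢ c ≐ u ⇒ c' ≐ u' ⇒ c ≐ c'
  ≐-through {u} {u'} c c' h =
    mp* (h ∷ ≐-trans⇒ c u u' ∷ ≐-sym⇒ c' u' ∷ ≐-trans⇒ c u' c' ∷ [])
        (tautology (p₀ ⟶ (p₁ ⟶ p₀ ⟶ p₂) ⟶ (p₃ ⟶ p₄) ⟶ (p₂ ⟶ p₄ ⟶ p₅) ⟶ p₁ ⟶ p₃ ⟶ p₅)
                   (u ≐ u' ∷ c ≐ u ∷ c ≐ u' ∷ c' ≐ u' ∷ u' ≐ c' ∷ c ≐ c' ∷ []))

  ≐-from-defined : ∀ c c' → ⊢ defd c ⇒ c ≐ c' → ⊢ defd c' ⇒ c' ≐ c → ⊢ c ≐ c'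
  ≐-from-defined c c' h h' =
    mp* (h ∷ h' ∷ ≐-sym⇒ c' c ∷ ≐-through c c' (eq-refl ↑) ∷ [])
        (tautology ((pneg p₀ ⟶ p₂) ⟶ (pneg p₁ ⟶ p₃) ⟶ (p₃ ⟶ p₂) ⟶ (p₀ ⟶ p₁ ⟶ p₂) ⟶ p₂)
                   (undef c ∷ undef c' ∷ c ≐ c' ∷ c' ≐ c ∷ []))

  eqs-intro : ∀ {n} (xs xs' : Vec Term n) → ((i : Fin n) → ⊢ lookup xs i ≐ lookup xs' i)
            → ⊢ eqs xs xs'
  eqs-intro []       []         _ = eq-refl ↑
  eqs-intro (_ ∷ xs) (_ ∷ xs') h =
    ⋀-cons (Vec.toList (Vec.zipWith _≐_ xs xs')) (h zero) (eqs-intro xs xs' (h ∘ suc))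

  pred-subst : ∀ {m n} (eq : m ≡ n) (P : Pred n) (zs : Vec Term m)
             → pred (subst Pred (sym eq) P) zs ≡ pred P (subst (Vec Term) eq zs)
  pred-subst refl P zs = refl

  -- Axiom eq-pred is stated for arities m + k; with k = 0 the predicate has to be
  -- transported along n + 0 ≡ n.
  eq-pred₀ : ∀ {n} (P : Pred n) (xs ys : Vec Term n) → ⊢ eqs xs ys ⇒ (pred P xs ⇔ pred P ys)
  eq-pred₀ {n} P xs ys =
    subst ⊢_ (cong₂ (λ φ ψ → eqs xs ys ⇒ (φ ⇔ ψ)) (drop-[] xs) (drop-[] ys))
          (eq-pred (subst Pred (sym (+-identityʳ n)) P) xs ys [])
    where
    drop-[] : ∀ zs → pred (subst Pred (sym (+-identityʳ n)) P) (zs ++ []) ≡ pred P zs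
    drop-[] zs = trans (pred-subst (+-identityʳ n) P (zs ++ []))
                       (cong (pred P) (trans (subst-is-cast _ (zs ++ [])) (++-identityʳ-eqFree zs)))

  cond-cong : ∀ {φ φ' x x' y y'} → ⊢ φ ⇔ φ' → ⊢ x ≐ x' → ⊢ y ≐ y'
            → ⊢ cond x φ y ≐ cond x' φ' y'
  cond-cong {φ} {φ'} {x} {x'} {y} {y'} hφ hx hy =
    mp* (hφ ∷ cond-ax φ x y ∷ cond-ax φ' x' y' ∷ ≐-through c c' hx ∷ ≐-through c c' hy ∷ [])
        (tautology ((p₀ ⟷ p₁) ⟶ pand (p₀ ⟶ p₂) (pneg p₀ ⟶ p₃) ⟶ pand (p₁ ⟶ p₄) (pneg p₁ ⟶ p₅)
                    ⟶ (p₂ ⟶ p₄ ⟶ p₆) ⟶ (p₃ ⟶ p₅ ⟶ p₆) ⟶ p₆)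
                   (φ ∷ φ' ∷ c ≐ x ∷ c ≐ y ∷ c' ≐ x' ∷ c' ≐ y' ∷ c ≐ c' ∷ []))
    where
    c  = cond x φ y
    c' = cond x' φ' y'

  app-cong : ∀ {x x'} e → ⊢ x ≐ x' → ⊢ app e x ≐ app e x'
  app-cong e hx = ≐-from-defined _ _ (⇒-trans (app-def e _) (≐-after-pre hx))
                                     (⇒-trans (app-def e _) (≐-after-pre (≐-sym hx)))
    where
    ≐-after-pre : ∀ {y y'} → ⊢ y ≐ y' → ⊢ pre e ⇒ app e y ≐ app e y'
    ≐-after-pre {y} {y'} h = mp (box-nec e h) (⇔-to (box-pred e eqP (y ∷ y' ∷ [])))

  K-map : ∀ {φ ψ} A → ⊢ φ ⇒ ψ → ⊢ K A φ ⇒ K A ψ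
  K-map {φ} {ψ} A h = mp (K-nec A h) (K-dist A φ ψ)

  K-map₂ : ∀ {φ ψ χ} A → ⊢ φ ⇒ ψ ⇒ χ → ⊢ K A φ ⇒ K A ψ ⇒ K A χ
  K-map₂ {φ} {ψ} {χ} A h = ⇒-trans (K-map A h) (K-dist A ψ χ)

  dK-map : ∀ A φ ψ → ⊢ K A (φ ⇒ ψ) ⇒ dK A φ ⇒ dK A ψ
  dK-map A φ ψ =
    mp* (K-map A (tautology ((p₀ ⟶ p₁) ⟶ pneg p₁ ⟶ pneg p₀) (φ ∷ ψ ∷ [])) ∷ K-dist A (neg ψ) (neg φ) ∷ [])
        (tautology ((p₀ ⟶ p₁) ⟶ (p₁ ⟶ p₂ ⟶ p₃) ⟶ p₀ ⟶ pneg p₃ ⟶ pneg p₂)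
                   (K A (φ ⇒ ψ) ∷ K A (neg ψ ⇒ neg φ) ∷ K A (neg ψ) ∷ K A (neg φ) ∷ []))

  -- If ψ were false, then ¬K_A ψ (axiom T), so K_A ¬K_A ψ (axiom 5), so K_A ¬ψ.
  dK-elim : ∀ A ψ → ⊢ ψ ⇒ K A ψ → ⊢ dK A ψ ⇒ ψ
  dK-elim A ψ h =
    mp* (K-5 A ψ ∷ K-map A (mp h (tautology ((p₀ ⟶ p₁) ⟶ pneg p₁ ⟶ pneg p₀) (ψ ∷ K A ψ ∷ [])))
         ∷ K-T A ψ ∷ [])
        (tautology ((pneg p₀ ⟶ p₁) ⟶ (p₁ ⟶ p₂) ⟶ (p₀ ⟶ p₃) ⟶ pneg p₂ ⟶ p₃)
                   (K A ψ ∷ K A (neg (K A ψ)) ∷ K A (neg ψ) ∷ ψ ∷ []))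

  kn-≐⇒K : ∀ A x φ x' φ' → ⊢ kn x A φ ≐ kn x' A φ' ⇒ K A (kn x A φ ≐ kn x' A φ')
  kn-≐⇒K A x φ x' φ' = mp (∧-intro (K-kn x A φ) (K-kn x' A φ')) (K-pred A eqP (kn x A φ ∷ kn x' A φ' ∷ []))

  KθT-cong : ∀ {φ φ' x x'} A → ⊢ φ ⇔ φ' → ⊢ x ≐ x' → ⊢ KθT A φ x ⇒ KθT A φ' x'
  KθT-cong {φ} {φ'} {x} {x'} A hφ hx =
    ⇒-trans (mp (K-nec A (mp hx (tautology (p₀ ⟶ p₁ ⟶ p₀) (x ≐ x' ∷ φ ∷ [])))) (K-eq A φ x x'))
            (mp (K-nec A (⇔-from hφ)) (K-weak A φ' φ x'))

  kn-defined⇒≐ : ∀ {φ φ' x x'} A → ⊢ φ ⇔ φ' → ⊢ x ≐ x'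
               → ⊢ defd (kn x A φ) ⇒ kn x A φ ≐ kn x' A φ'
  kn-defined⇒≐ {φ} {φ'} {x} {x'} A hφ hx =
    mp* (kn-def x A φ ∷ KθT-cong A hφ hx ∷ K-map₂ A same-value ∷ dK-map A φ (k ≐ k')
         ∷ dK-elim A (k ≐ k') (kn-≐⇒K A x φ x' φ') ∷ [])
        (tautology ((p₀ ⟶ pand p₁ p₂) ⟶ (p₁ ⟶ p₃) ⟶ (p₁ ⟶ p₃ ⟶ p₄) ⟶ (p₄ ⟶ p₂ ⟶ p₅)
                    ⟶ (p₅ ⟶ p₆) ⟶ p₀ ⟶ p₆)
                   (defd k ∷ KθT A φ x ∷ dK A φ ∷ KθT A φ' x' ∷ K A (φ ⇒ k ≐ k')
                    ∷ dK A (k ≐ k') ∷ k ≐ k' ∷ []))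
    where
    k  = kn x A φ
    k' = kn x' A φ'
    same-value : ⊢ (φ ⇒ x ≐ k) ⇒ (φ' ⇒ x' ≐ k') ⇒ (φ ⇒ k ≐ k')
    same-value =
      mp* (⇔-to hφ ∷ ≐-sym⇒ x k ∷ ≐-sym⇒ x' k' ∷ ≐-through k k' hx ∷ [])
          (tautology ((p₀ ⟶ p₁) ⟶ (p₂ ⟶ p₃) ⟶ (p₄ ⟶ p₅) ⟶ (p₃ ⟶ p₅ ⟶ p₆)
                      ⟶ (p₀ ⟶ p₂) ⟶ (p₁ ⟶ p₄) ⟶ p₀ ⟶ p₆)
                     (φ ∷ φ' ∷ x ≐ k ∷ k ≐ x ∷ x' ≐ k' ∷ k' ≐ x' ∷ k ≐ k' ∷ []))

  kn-cong : ∀ {φ φ' x x'} A → ⊢ φ ⇔ φ' → ⊢ x ≐ x' → ⊢ kn x A φ ≐ kn x' A φ'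
  kn-cong A hφ hx = ≐-from-defined _ _ (kn-defined⇒≐ A hφ hx) (kn-defined⇒≐ A (⇔-sym hφ) (≐-sym hx))

  box-map : ∀ {φ ψ} e → ⊢ φ ⇒ ψ → ⊢ box e φ ⇒ box e ψ
  box-map {φ} {ψ} e h = mp (box-nec e h) (box-dist e φ ψ)

  C-map : ∀ {φ ψ} 𝔄 θ → ⊢ φ ⇒ ψ → ⊢ C 𝔄 θ φ ⇒ C 𝔄 θ ψ
  C-map {φ} {ψ} 𝔄 θ h = mp (C-nec 𝔄 θ h) (C-dist 𝔄 θ φ ψ)

  Kθ-antitone : ∀ {θ θ'} A ψ → ⊢ θ' ⇒ θ → ⊢ Kθ A θ ψ ⇒ Kθ A θ' ψ
  Kθ-antitone {θ} {θ'} A ψ h =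
    K-map A (mp h (tautology ((p₁ ⟶ p₀) ⟶ (p₀ ⟶ p₂) ⟶ p₁ ⟶ p₂) (θ ∷ θ' ∷ ψ ∷ [])))

  -- C_𝔄^θ φ is a fixpoint for the weaker condition θ', so the induction axiom applies.
  C-mono : ∀ {θ θ' φ φ'} 𝔄 → ⊢ θ' ⇒ θ → ⊢ φ ⇒ φ' → ⊢ C 𝔄 θ φ ⇒ C 𝔄 θ' φ'
  C-mono {θ} {θ'} {φ} {φ'} 𝔄 hθ hφ =
    ⇒-trans (mp (C-nec 𝔄 θ' fixpoint) (C-ind 𝔄 θ' ψ))
            (C-map 𝔄 θ' (⇒-trans (⇒-trans (C-mix 𝔄 θ φ) (∧-proj₁⇒ _ _)) hφ))
    where
    ψ = C 𝔄 θ φ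
    fixpoint : ⊢ ψ ⇒ ⋀ (map (λ A → Kθ A θ' ψ) (toList 𝔄))
    fixpoint = ⇒-trans (⇒-trans (C-mix 𝔄 θ φ) (∧-proj₂⇒ _ _))
                       (⋀-map-mono (toList 𝔄) (λ A → Kθ-antitone A ψ hθ))

  C-cong : ∀ {θ θ' φ φ'} 𝔄 → ⊢ θ ⇔ θ' → ⊢ φ ⇔ φ' → ⊢ C 𝔄 θ φ ⇔ C 𝔄 θ' φ'
  C-cong 𝔄 hθ hφ = ∧-intro (C-mono 𝔄 (⇔-from hθ) (⇔-to hφ)) (C-mono 𝔄 (⇔-to hθ) (⇔-from hφ))

lemma14 : (S : Sig) → let open Syntax S in
    ∀ {n} (φ φ' θ θ' : Form) (x x' y y' : Term) (xs xs' : Vec Term n)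
    → ⊢ φ ⇔ φ' → ⊢ θ ⇔ θ' → ⊢ x ≐ x' → ⊢ y ≐ y'
    → ((i : Fin n) → ⊢ lookup xs i ≐ lookup xs' i)
    → (A : Group) (𝔄 : SuperGroup) (e : Event) (F : Fun n) (P : Pred n)
    → (⊢ cond x φ y ≐ cond x' φ' y')
    × (⊢ fun F xs ≐ fun F xs')
    × (⊢ kn x A φ ≐ kn x' A φ')
    × (⊢ app e x ≐ app e x')
    × (⊢ pred P xs ⇔ pred P xs')
    × (⊢ neg φ ⇔ neg φ')
    × (⊢ and φ θ ⇔ and φ' θ')
    × (⊢ K A φ ⇔ K A φ')
    × (⊢ box e φ ⇔ box e φ')
    × (⊢ C 𝔄 θ φ ⇔ C 𝔄 θ' φ')
lemma14 S φ φ' θ θ' x x' y y' xs xs' hφ hθ hx hy hxs A 𝔄 e F P =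
    cond-cong hφ hx hy
  , mp xs≐xs' (eq-fun F xs xs')
  , kn-cong A hφ hx
  , app-cong e hx
  , mp xs≐xs' (eq-pred₀ P xs xs')
  , neg-cong hφ
  , and-cong hφ hθ
  , ⇔-lift (K-map A) hφ
  , ⇔-lift (box-map e) hφ
  , C-cong 𝔄 hθ hφ
  where
  open Syntax S
  open Derivations S
  xs≐xs' : ⊢ eqs xs xs'
  xs≐xs' = eqs-intro xs xs' hxs
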